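{- For all positive integers $m,w$ with $m>1$, $$\frac{w^{\lg (m-1)}}{m-1} \le \operatorname{val}_{\mathrm{FF}}(L_m,w).$$
   Context: For a positive integer $m$, an $m$-ladder $L_m$ is the poset on two disjoint chains $x_1<x_2<\dots<x_m$ and $y_1<y_2<\dots<y_m$ with $x_i<y_i$ for all $i\in[m]$, $y_i\parallel x_j$ whenever $i<j\le m$, and all other relations given by transitivity. A poset is $L_m$-free if it contains no induced subposet isomorphic to $L_m$. The First-Fit algorithm, given an on-line poset (a finite poset together with a linear presentation order $\prec$ of its vertices), assigns each new vertex $v_i$ to the chain $C_j$ with the least index $j\ge 1$ such that every previously presented vertex in $C_j$ is comparable to $v_i$. $\chi_{\mathrm{FF}}(P)$ is the maximum, over all presentation orders of $P$, of the number of chains First-Fit uses. $\operatorname{val}_{\mathrm{FF}}(L_m,w)$ is the maximum of $\chi_{\mathrm{FF}}(P)$ over all finite $L_m$-free posets $P$ of width at most $w$. $\lg$ is the logarithm to base $2$. -}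

module Defs where

open import Level using (0ℓ)
open import Data.Nat as ℕ using (ℕ; suc; _^_; _*_; _∸_)
open import Data.Fin as Fin using (Fin)
open import Data.Sum using (_⊎_; inj₁; inj₂)
open import Data.Product using (_×_; ∃; Σ-syntax)
open import Data.Empty using (⊥)
open import Data.Unit using (⊤)
open import Relation.Nullary using (¬_)
open import Relation.Binary.PropositionalEquality using (_≡_; _≢_)
open import Relation.Binary.Structures using (IsPartialOrder)
open import Function.Definitions using (Injective)
open import Function.Bundles using (_⇔_)
open import Data.Fin.Permutation using (Permutation′; _⟨$⟩ʳ_)

record FinPoset : Set₁ where
  field
    size  : ℕ
    _⊑_   : Fin size → Fin size → Set
    isPO  : IsPartialOrder _≡_ _⊑_

open FinPoset public

Comp : (P : FinPoset) → Fin (size P) → Fin (size P) → Set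
Comp P x y = _⊑_ P x y ⊎ _⊑_ P y x

Incomp : (P : FinPoset) → Fin (size P) → Fin (size P) → Set
Incomp P x y = ¬ Comp P x y

WidthAtMost : FinPoset → ℕ → Set
WidthAtMost P w =
  (f : Fin (suc w) → Fin (size P)) → Injective _≡_ _≡_ f →
  ¬ (∀ i j → i ≢ j → Incomp P (f i) (f j))

-- The m-ladder L_m on Fin m ⊎ Fin m : inj₁ i = x_(i+1), inj₂ i = y_(i+1).
-- x_i ≤ x_j iff i ≤ j ; y_i ≤ y_j iff i ≤ j ; x_i ≤ y_j iff i ≤ j ;
-- y_i ≤ x_j never (these are exactly the relations generated by
-- the two chains, x_i < y_i, with y_i ∥ x_j for i < j).
LadderLe : (m : ℕ) → Fin m ⊎ Fin m → Fin m ⊎ Fin m → Set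
LadderLe m (inj₁ i) (inj₁ j) = i Fin.≤ j
LadderLe m (inj₂ i) (inj₂ j) = i Fin.≤ j
LadderLe m (inj₁ i) (inj₂ j) = i Fin.≤ j
LadderLe m (inj₂ i) (inj₁ j) = ⊥

ContainsLadder : ℕ → FinPoset → Set
ContainsLadder m P =
  Σ[ e ∈ (Fin m ⊎ Fin m → Fin (size P)) ]
    (Injective _≡_ _≡_ e ×
     (∀ a b → LadderLe m a b ⇔ _⊑_ P (e a) (e b)))

LadderFree : ℕ → FinPoset → Set
LadderFree m P = ¬ ContainsLadder m P

-- First-Fit run on P with presentation order σ (time t ↦ vertex σ t):
-- f t is the (1-based) index of the chain receiving the vertex presented at time t,
-- namely the least j ≥ 1 such that all earlier vertices in chain j are
-- comparable to it.
FirstFitRun : (P : FinPoset) → Permutation′ (size P) → (Fin (size P) → ℕ) → Set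
FirstFitRun P σ f =
  ∀ i →
    (1 ℕ.≤ f i) ×
    (∀ t → t Fin.< i → f t ≡ f i → Comp P (σ ⟨$⟩ʳ t) (σ ⟨$⟩ʳ i)) ×
    (∀ j → 1 ℕ.≤ j → j ℕ.< f i →
       ∃ λ t → t Fin.< i × f t ≡ j × Incomp P (σ ⟨$⟩ʳ t) (σ ⟨$⟩ʳ i))

FirstFitUses : (P : FinPoset) → Permutation′ (size P) → ℕ → Set
FirstFitUses P σ k =
  ∃ λ f → FirstFitRun P σ f × (∀ i → f i ℕ.≤ k) × (k ≡ 0 ⊎ ∃ λ i → f i ≡ k)

-- The real inequality  w ^ (lg a) / a ≤ V  (a ≥ 1, w ≥ 1), i.e.
-- w ^ (lg a) ≤ a * V, encoded via rationals p/q ≤ lg a (⇔ 2^p ≤ a^q):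
-- w^(lg a) = sup { w^(p/q) : p/q ≤ lg a } and w^(p/q) ≤ aV ⇔ w^p ≤ (aV)^q.
PowLgBound : (w a V : ℕ) → Set
PowLgBound w a V =
  ∀ p q → 1 ℕ.≤ q → 2 ^ p ℕ.≤ a ^ q → w ^ p ℕ.≤ (a * V) ^ q

{-# OPTIONS --safe #-}
-- Let T_n be the poset on {(c , l) : c + l ≤ n} in which (c , l) ≤ (c′ , l′) iff c ≤ c′ and l ≤ l′,
-- or c′ < c and l + 2 ≤ l′.  Presented colour class by colour class, First-Fit puts (c , l) into
-- chain c: its own class is a chain, and for each c′ < c it is incomparable to the earlier
-- (c′ , l + 1).  So First-Fit uses n + 1 chains on T_n, the parity of l splits T_n into 2 chains,
-- and (c , l) is incomparable only to elements (c′ , l ± 1), at most one per colour c′ ≠ c.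
--
-- In a lexicographic product Q[P], First-Fit's chain counts and the chain partitions multiply.
-- A copy of L_(n+2) minus x_1 and y_(n+2) in Q[P] either lies in a single copy of P, or its n + 1
-- x's lie in distinct copies that are all incomparable in Q to the copy containing y_1, which is
-- impossible for Q = T_n.  Hence the t-fold power of T_(m-2), with 2^t ≤ w < 2^(t+1), is L_m-free
-- of width at most 2^t ≤ w, and First-Fit uses (m - 1)^t ≥ w^(lg (m - 1)) / (m - 1) chains on it.
module Submission where

open import Defs
open import Data.Nat using (ℕ; _≤_; _∸_)
open import Data.Product using (_×_; Σ-syntax)
open import Data.Fin.Permutation using (Permutation′)

open import Data.Nat.Base using (zero; suc; _+_; _*_; _^_; _<_; z≤n; s≤s; s≤s⁻¹)
open import Data.Nat.Properties
open import Data.Fin.Base as Fin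
  using (Fin; toℕ; fromℕ; fromℕ<; inject₁; splitAt; join; _↑ˡ_; _↑ʳ_; combine; remQuot; quotient;
         remainder)
import Data.Fin.Properties as Finₚ
import Data.Fin.Permutation as Permutation
open import Data.Product using (∃; _,_; proj₁; proj₂; uncurry; map₁; map₂)
open import Data.Product.Properties using (,-injectiveˡ; ,-injectiveʳ)
open import Data.Product.Relation.Binary.Pointwise.NonDependent using (Pointwise; ≡×≡⇒≡)
open import Data.Product.Relation.Binary.Lex.NonStrict using (×-Lex; ×-isPartialOrder)
open import Data.Sum using (_⊎_; inj₁; inj₂; [_,_]′; swap)
open import Data.Empty using (⊥; ⊥-elim)
open import Data.Unit using (⊤; tt)
open import Data.Vec.Functional using (_∷_)
open import Function.Base using (_on_; _∘_)
open import Function.Bundles using (Equivalence)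
open import Function.Definitions using (Injective)
open import Relation.Binary.Definitions using (tri<; tri≈; tri>)
open import Relation.Binary.PropositionalEquality
open import Relation.Binary.Structures using (IsPartialOrder)
open import Relation.Nullary using (¬_; yes; no; contradiction)

isPartialOrder-on : {A B : Set} {_≈_ _≤′_ : B → B → Set} (f : A → B) →
                    (∀ {x y} → f x ≈ f y → x ≡ y) →
                    IsPartialOrder _≈_ _≤′_ → IsPartialOrder _≡_ (_≤′_ on f)
isPartialOrder-on f injective po = record
  { isPreorder = record
    { isEquivalence = isEquivalence
    ; reflexive     = λ { refl → PO.refl }
    ; trans         = PO.trans
    }
  ; antisym = λ x≤y y≤x → injective (PO.antisym x≤y y≤x)
  }
  where module PO = IsPartialOrder po

-- First-Fit presenting the elements in the order of Fin; colour c is the chain C_(c+1).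
record FirstFitColouring (P : FinPoset) (k : ℕ) : Set where
  field
    colour     : Fin (size P) → Fin k
    surjective : ∀ c → ∃ λ x → colour x ≡ c
    fits       : ∀ {t i} → t Fin.< i → colour t ≡ colour i → Comp P t i
    blocked    : ∀ i {c} → c Fin.< colour i → ∃ λ t → t Fin.< i × colour t ≡ c × Incomp P t i

firstFitUses : ∀ {P k} → FirstFitColouring P k → FirstFitUses P Permutation.id k
firstFitUses {P} {k} ff = suc ∘ toℕ ∘ colour , run , toℕ<n ∘ colour , attainsTop k colour surjective
  where
  open FirstFitColouring ff
  open Finₚ using (toℕ<n; toℕ-fromℕ<)

  run : FirstFitRun P Permutation.id (suc ∘ toℕ ∘ colour)
  run i = s≤s z≤n , (λ t t<i same → fits t<i (Finₚ.toℕ-injective (suc-injective same))) , blockedBelow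
    where
    blockedBelow : ∀ j → 1 ≤ j → j < suc (toℕ (colour i)) →
                   ∃ λ t → t Fin.< i × suc (toℕ (colour t)) ≡ j × Incomp P t i
    blockedBelow (suc j) _ (s≤s j<ci)
      with t , t<i , ct≡c , incomparable ← blocked i {fromℕ< (<-trans j<ci (toℕ<n (colour i)))}
                                             (subst (_< toℕ (colour i)) (sym (toℕ-fromℕ< _)) j<ci)
      = t , t<i , cong suc (trans (cong toℕ ct≡c) (toℕ-fromℕ< _)) , incomparable

  attainsTop : ∀ n (f : Fin (size P) → Fin n) → (∀ c → ∃ λ x → f x ≡ c) →
               n ≡ 0 ⊎ ∃ λ x → suc (toℕ (f x)) ≡ n
  attainsTop zero    _ _ = inj₁ refl
  attainsTop (suc n) f onto with x , fx≡top ← onto (fromℕ n) =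
    inj₂ (x , cong suc (trans (cong toℕ fx≡top) (Finₚ.toℕ-fromℕ n)))

record ChainCover (P : FinPoset) (w : ℕ) : Set where
  field
    chain      : Fin (size P) → Fin w
    comparable : ∀ {x y} → chain x ≡ chain y → Comp P x y

chainCover⇒widthAtMost : ∀ {P w v} → ChainCover P w → w ≤ v → WidthAtMost P v
chainCover⇒widthAtMost cover w≤v f _ antichain
  with i , j , i<j , sameChain ← Finₚ.pigeonhole (s≤s w≤v) (ChainCover.chain cover ∘ f)
  = antichain i j (Finₚ.<⇒≢ i<j) (ChainCover.comparable cover sameChain)

IncomparableToFewerThan : ℕ → FinPoset → Set
IncomparableToFewerThan r P =
  ∀ q (h : Fin r → Fin (size P)) → Injective _≡_ _≡_ h → ¬ (∀ i → Incomp P (h i) q)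

-- L_(r+1) without x_1 and y_(r+1): x i and y j stand for x_(i+2) and y_(j+1), so x i ⊑ y j iff i < j.
record TruncatedLadder (r : ℕ) (P : FinPoset) : Set where
  field
    x y    : Fin r → Fin (size P)
    x-mono : ∀ {i j} → i Fin.≤ j → _⊑_ P (x i) (x j)
    y-mono : ∀ {i j} → i Fin.≤ j → _⊑_ P (y i) (y j)
    x⊑y    : ∀ {i j} → i Fin.< j → _⊑_ P (x i) (y j)
    x⋢y    : ∀ {i j} → j Fin.≤ i → ¬ _⊑_ P (x i) (y j)
    y⋢x    : ∀ i j → ¬ _⊑_ P (y i) (x j)

TruncatedLadderFree : ℕ → FinPoset → Set
TruncatedLadderFree r P = ¬ TruncatedLadder r P

truncatedLadderFree⇒ladderFree : ∀ {r P} → TruncatedLadderFree r P → LadderFree (suc r) P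
truncatedLadderFree⇒ladderFree free (e , _ , iff) = free record
  { x      = λ i → e (inj₁ (Fin.suc i))
  ; y      = λ j → e (inj₂ (inject₁ j))
  ; x-mono = λ i≤j → to (iff _ _) (s≤s i≤j)
  ; y-mono = λ {i} {j} i≤j → to (iff _ _) (subst₂ _≤_ (sym (toℕ-inject₁ i)) (sym (toℕ-inject₁ j)) i≤j)
  ; x⊑y    = λ {_} {j} i<j → to (iff _ _) (subst (_ ≤_) (sym (toℕ-inject₁ j)) i<j)
  ; x⋢y    = λ {_} {j} j≤i x⊑y → ≤⇒≯ j≤i (subst (_ ≤_) (toℕ-inject₁ j) (from (iff _ _) x⊑y))
  ; y⋢x    = λ _ _ → from (iff _ _)
  }
  where
  open Equivalence
  open Finₚ using (toℕ-inject₁)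

point : FinPoset
point = record
  { size = 1
  ; _⊑_  = λ _ _ → ⊤
  ; isPO = record
    { isPreorder = record { isEquivalence = isEquivalence ; reflexive = λ _ → tt ; trans = λ _ _ → tt }
    ; antisym    = λ { {Fin.zero} {Fin.zero} _ _ → refl }
    }
  }

point-firstFit : FirstFitColouring point 1
point-firstFit = record
  { colour     = λ x → x
  ; surjective = λ c → c , refl
  ; fits       = λ _ _ → inj₁ tt
  ; blocked    = λ { Fin.zero () }
  }

point-chainCover : ChainCover point 1
point-chainCover = record { chain = λ x → x ; comparable = λ _ → inj₁ tt }

point-truncatedLadderFree : ∀ {r} → TruncatedLadderFree (suc r) point
point-truncatedLadderFree ladder = TruncatedLadder.x⋢y ladder {Fin.zero} z≤n tt

combine-monoʳ-< : ∀ {m n} (i : Fin m) {j k : Fin n} → j Fin.< k → combine i j Fin.< combine i k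
combine-monoʳ-< {n = n} i {j} {k} j<k = begin-strict
  toℕ (combine i j)     ≡⟨ Finₚ.toℕ-combine i j ⟩
  n * toℕ i + toℕ j     <⟨ +-monoʳ-< (n * toℕ i) j<k ⟩
  n * toℕ i + toℕ k     ≡⟨ Finₚ.toℕ-combine i k ⟨
  toℕ (combine i k)     ∎
  where open ≤-Reasoning

combine-<-cases : ∀ {m n} {i i′ : Fin m} {j j′ : Fin n} → combine i j Fin.< combine i′ j′ →
                  i Fin.< i′ ⊎ (i ≡ i′ × j Fin.< j′)
combine-<-cases {i = i} {i′} {j} {j′} lt with Finₚ.<-cmp i i′
... | tri< i<i′ _ _ = inj₁ i<i′
... | tri> _ _ i′<i = contradiction lt (<-asym (Finₚ.combine-monoˡ-< j′ j i′<i))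
... | tri≈ _ refl _ with Finₚ.<-cmp j j′
...   | tri< j<j′ _ _ = inj₂ (refl , j<j′)
...   | tri≈ _ refl _ = contradiction lt (<-irrefl refl)
...   | tri> _ _ j′<j = contradiction lt (<-asym (combine-monoʳ-< i j′<j))

remQuot-injective : ∀ {m} n {x y : Fin (m * n)} →
                    Pointwise (_≡_ {A = Fin m}) (_≡_ {A = Fin n}) (remQuot n x) (remQuot n y) → x ≡ y
remQuot-injective {m} n {x} {y} same = begin
  x                                 ≡⟨ Finₚ.combine-remQuot {m} n x ⟨
  uncurry combine (remQuot {m} n x) ≡⟨ cong (uncurry combine) (≡×≡⇒≡ same) ⟩
  uncurry combine (remQuot {m} n y) ≡⟨ Finₚ.combine-remQuot {m} n y ⟩
  y                                 ∎
  where open ≡-Reasoning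

splitAt-injective : ∀ m {n} {x y : Fin (m + n)} → splitAt m x ≡ splitAt m y → x ≡ y
splitAt-injective m {n} {x} {y} same = begin
  x                    ≡⟨ Finₚ.join-splitAt m n x ⟨
  join m n (splitAt m x) ≡⟨ cong (join m n) same ⟩
  join m n (splitAt m y) ≡⟨ Finₚ.join-splitAt m n y ⟩
  y                    ∎
  where open ≡-Reasoning

-- Q[P]: every element of Q is blown up into a copy of P; the copies are presented one after another.
lex : FinPoset → FinPoset → FinPoset
lex Q P = record
  { size = size Q * size P
  ; _⊑_  = ×-Lex _≡_ (_⊑_ Q) (_⊑_ P) on remQuot (size P)
  ; isPO = isPartialOrder-on (remQuot (size P)) (remQuot-injective {size Q} (size P))
                             (×-isPartialOrder (isPO Q) (isPO P))
  }

module _ {Q P : FinPoset} where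
  private
    _⊑Q_ = _⊑_ Q
    _⊑P_ = _⊑_ P
    _⊑L_ = _⊑_ (lex Q P)

    block : Fin (size Q * size P) → Fin (size Q)
    block = quotient (size P)

    inner : Fin (size Q * size P) → Fin (size P)
    inner = remainder {size Q} (size P)

    block-combine : ∀ (a : Fin (size Q)) (b : Fin (size P)) → block (combine a b) ≡ a
    block-combine a b = cong proj₁ (Finₚ.remQuot-combine a b)

    inner-combine : ∀ (a : Fin (size Q)) (b : Fin (size P)) → inner (combine a b) ≡ b
    inner-combine a b = cong proj₂ (Finₚ.remQuot-combine a b)

    combine-block-inner : ∀ x → combine (block x) (inner x) ≡ x
    combine-block-inner = Finₚ.combine-remQuot {size Q} (size P)

    across : ∀ {u v w z} → block u ≢ block w → u ⊑L w → block v ≡ block u → block z ≡ block w → v ⊑L z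
    across u≢w (inj₁ (u⊑w , _)) v≡u z≡w =
      inj₁ (subst₂ _⊑Q_ (sym v≡u) (sym z≡w) u⊑w , λ v≡z → u≢w (trans (sym v≡u) (trans v≡z z≡w)))
    across u≢w (inj₂ (u≡w , _)) _ _ = contradiction u≡w u≢w

    within : ∀ {u w} → block u ≡ block w → u ⊑L w → inner u ⊑P inner w
    within u≡w (inj₁ (_ , u≢w)) = contradiction u≡w u≢w
    within _   (inj₂ (_ , u⊑w)) = u⊑w

    block-mono : ∀ {u w} → u ⊑L w → block u ⊑Q block w
    block-mono (inj₁ (u⊑w , _)) = u⊑w
    block-mono (inj₂ (u≡w , _)) = IsPartialOrder.reflexive (isPO Q) u≡w

    comparable-blocks : ∀ {u w} → Comp (lex Q P) u w → Comp Q (block u) (block w)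
    comparable-blocks (inj₁ u⊑w) = inj₁ (block-mono u⊑w)
    comparable-blocks (inj₂ w⊑u) = inj₂ (block-mono w⊑u)

    comparable-inners : ∀ {u w} → block u ≡ block w → Comp (lex Q P) u w → Comp P (inner u) (inner w)
    comparable-inners u≡w (inj₁ u⊑w) = inj₁ (within u≡w u⊑w)
    comparable-inners u≡w (inj₂ w⊑u) = inj₂ (within (sym u≡w) w⊑u)

    comparable-across : ∀ {u w} → block u ≢ block w → Comp Q (block u) (block w) → Comp (lex Q P) u w
    comparable-across u≢w (inj₁ u⊑w) = inj₁ (inj₁ (u⊑w , u≢w))
    comparable-across u≢w (inj₂ w⊑u) = inj₂ (inj₁ (w⊑u , u≢w ∘ sym))

    comparable-within : ∀ {u w} → block u ≡ block w → Comp P (inner u) (inner w) → Comp (lex Q P) u w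
    comparable-within u≡w (inj₁ u⊑w) = inj₁ (inj₂ (u≡w , u⊑w))
    comparable-within u≡w (inj₂ w⊑u) = inj₂ (inj₂ (sym u≡w , w⊑u))

    earlier-cases : ∀ {t i} → t Fin.< i →
                    block t Fin.< block i ⊎ (block t ≡ block i × inner t Fin.< inner i)
    earlier-cases {t} {i} t<i =
      combine-<-cases (subst₂ Fin._<_ (sym (combine-block-inner t)) (sym (combine-block-inner i)) t<i)

    earlier-block : ∀ {a i} b → a Fin.< block i → combine a b Fin.< i
    earlier-block {a} {i} b a<i =
      subst (combine a b Fin.<_) (combine-block-inner i) (Finₚ.combine-monoˡ-< b (inner i) a<i)

    earlier-inner : ∀ {b i} → b Fin.< inner i → combine (block i) b Fin.< i
    earlier-inner {b} {i} b<i =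
      subst (combine (block i) b Fin.<_) (combine-block-inner i) (combine-monoʳ-< (block i) {b} b<i)

  lex-firstFit : ∀ {k l} → FirstFitColouring Q k → FirstFitColouring P l →
                 FirstFitColouring (lex Q P) (k * l)
  lex-firstFit {k} {l} ffQ ffP = record
    { colour = colour ; surjective = surjective ; fits = fits ; blocked = blocked }
    where
    module FQ = FirstFitColouring ffQ
    module FP = FirstFitColouring ffP

    colour : Fin (size Q * size P) → Fin (k * l)
    colour x = combine (FQ.colour (block x)) (FP.colour (inner x))

    colour-combine : ∀ (a : Fin (size Q)) (b : Fin (size P)) →
                     colour (combine a b) ≡ combine (FQ.colour a) (FP.colour b)
    colour-combine a b =
      cong₂ (λ a b → combine (FQ.colour a) (FP.colour b)) (block-combine a b) (inner-combine a b)

    surjective : ∀ c → ∃ λ x → colour x ≡ c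
    surjective c with Finₚ.combine-surjective {k} {l} c
    ... | cq , cp , refl with FQ.surjective cq | FP.surjective cp
    ...   | a , refl | b , refl = combine a b , colour-combine a b

    fits : ∀ {t i} → t Fin.< i → colour t ≡ colour i → Comp (lex Q P) t i
    fits t<i same with Finₚ.combine-injective _ _ _ _ same | earlier-cases t<i
    ... | sameQ , _ | inj₁ t<iQ = comparable-across (Finₚ.<⇒≢ t<iQ) (FQ.fits t<iQ sameQ)
    ... | _ , sameP | inj₂ (t≡iQ , t<iP) = comparable-within t≡iQ (FP.fits t<iP sameP)

    blocked : ∀ i {c} → c Fin.< colour i → ∃ λ t → t Fin.< i × colour t ≡ c × Incomp (lex Q P) t i
    blocked i {c} c<ci with cq , cp , refl ← Finₚ.combine-surjective {k} {l} c | combine-<-cases c<ci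
    ... | inj₁ cq<
      with a , a<i , refl , a∥i ← FQ.blocked (block i) cq< | b , refl ← FP.surjective cp
      = combine a b , earlier-block b a<i , colour-combine a b ,
        λ comparable → a∥i (subst (λ a → Comp Q a (block i)) (block-combine a b)
                                  (comparable-blocks comparable))
    ... | inj₂ (refl , cp<)
      with b , b<i , refl , b∥i ← FP.blocked (inner i) cp<
      = combine (block i) b , earlier-inner b<i , colour-combine (block i) b ,
        λ comparable → b∥i (subst (λ b → Comp P b (inner i)) (inner-combine (block i) b)
                                  (comparable-inners (block-combine (block i) b) comparable))

  lex-chainCover : ∀ {v w} → ChainCover Q v → ChainCover P w → ChainCover (lex Q P) (v * w)
  lex-chainCover {v} {w} coverQ coverP = record { chain = chain ; comparable = comparable }
    where
    module CQ = ChainCover coverQ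
    module CP = ChainCover coverP

    chain : Fin (size Q * size P) → Fin (v * w)
    chain x = combine (CQ.chain (block x)) (CP.chain (inner x))

    comparable : ∀ {x y} → chain x ≡ chain y → Comp (lex Q P) x y
    comparable {x} {y} same with Finₚ.combine-injective _ _ _ _ same | block x Finₚ.≟ block y
    ... | _ , sameP | yes x≡y = comparable-within x≡y (CP.comparable sameP)
    ... | sameQ , _ | no x≢y  = comparable-across x≢y (CQ.comparable sameQ)

  private
    module LadderInLex {r} (ladder : TruncatedLadder (suc r) (lex Q P)) where
      open TruncatedLadder ladder

      x-block : block (x Fin.zero) ≡ block (y Fin.zero) → ∀ i → block (x i) ≡ block (x Fin.zero)
      x-block x₀≡y₀ i with block (x i) Finₚ.≟ block (x Fin.zero)
      ... | yes same  = same
      ... | no differ = ⊥-elim (y⋢x Fin.zero i (across (differ ∘ sym) (x-mono z≤n) (sym x₀≡y₀) refl))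

      y-block : block (x Fin.zero) ≡ block (y Fin.zero) → ∀ j → block (y j) ≡ block (x Fin.zero)
      y-block x₀≡y₀ Fin.zero    = sym x₀≡y₀
      y-block x₀≡y₀ (Fin.suc j) with block (y (Fin.suc j)) Finₚ.≟ block (x Fin.zero)
      ... | yes same  = same
      ... | no differ = ⊥-elim (x⋢y {Fin.suc j} ≤-refl
          (across (differ ∘ sym) (x⊑y {Fin.zero} (s≤s z≤n)) (x-block x₀≡y₀ (Fin.suc j)) refl))

      projection : block (x Fin.zero) ≡ block (y Fin.zero) → TruncatedLadder (suc r) P
      projection x₀≡y₀ = record
        { x      = inner ∘ x
        ; y      = inner ∘ y
        ; x-mono = λ {i} {j} i≤j → within (same (xb i) (xb j)) (x-mono i≤j)
        ; y-mono = λ {i} {j} i≤j → within (same (yb i) (yb j)) (y-mono i≤j)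
        ; x⊑y    = λ {i} {j} i<j → within (same (xb i) (yb j)) (x⊑y i<j)
        ; x⋢y    = λ {i} {j} j≤i xi⊑yj → x⋢y j≤i (inj₂ (same (xb i) (yb j) , xi⊑yj))
        ; y⋢x    = λ i j yi⊑xj → y⋢x i j (inj₂ (same (yb i) (xb j) , yi⊑xj))
        }
        where
        xb = x-block x₀≡y₀
        yb = y-block x₀≡y₀
        same : ∀ {u w} → block u ≡ block (x Fin.zero) → block w ≡ block (x Fin.zero) → block u ≡ block w
        same u≡ w≡ = trans u≡ (sym w≡)

      module _ (x₀≢y₀ : block (x Fin.zero) ≢ block (y Fin.zero)) where
        x≢y₀ : ∀ i → block (x i) ≢ block (y Fin.zero)
        x≢y₀ i xi≡y₀ = x⋢y {Fin.zero} z≤n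
          (across (λ x₀≡xi → x₀≢y₀ (trans x₀≡xi xi≡y₀)) (x-mono {Fin.zero} {i} z≤n) refl (sym xi≡y₀))

        x∥y₀ : ∀ i → Incomp Q (block (x i)) (block (y Fin.zero))
        x∥y₀ i (inj₁ xi⊑y₀) = x⋢y {i} z≤n (inj₁ (xi⊑y₀ , x≢y₀ i))
        x∥y₀ i (inj₂ y₀⊑xi) = y⋢x Fin.zero i (inj₁ (y₀⊑xi , x≢y₀ i ∘ sym))

        x-blocks-distinct : ∀ {i j} → i Fin.< j → block (x i) ≢ block (x j)
        x-blocks-distinct {i} {j} i<j xi≡xj with block (y j) Finₚ.≟ block (x i)
        ... | no yj≢xi  = x⋢y {j} ≤-refl (across (yj≢xi ∘ sym) (x⊑y i<j) (sym xi≡xj) refl)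
        ... | yes yj≡xi = y⋢x Fin.zero j
          (across (λ y₀≡yj → x≢y₀ j (trans xj≡yj (sym y₀≡yj))) (y-mono z≤n) refl xj≡yj)
          where xj≡yj = trans (sym xi≡xj) (sym yj≡xi)

        x-blocks-injective : Injective _≡_ _≡_ (block ∘ x)
        x-blocks-injective {i} {j} same with Finₚ.<-cmp i j
        ... | tri< i<j _ _ = contradiction same (x-blocks-distinct i<j)
        ... | tri≈ _ i≡j _ = i≡j
        ... | tri> _ _ j<i = contradiction (sym same) (x-blocks-distinct j<i)

      refute : IncomparableToFewerThan (suc r) Q → TruncatedLadderFree (suc r) P → ⊥
      refute few free with block (x Fin.zero) Finₚ.≟ block (y Fin.zero)
      ... | yes x₀≡y₀ = free (projection x₀≡y₀)
      ... | no x₀≢y₀  = few (block (y Fin.zero)) (block ∘ x) (x-blocks-injective x₀≢y₀) (x∥y₀ x₀≢y₀)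

  lex-truncatedLadderFree : ∀ {r} → IncomparableToFewerThan (suc r) Q → TruncatedLadderFree (suc r) P →
                            TruncatedLadderFree (suc r) (lex Q P)
  lex-truncatedLadderFree few free ladder = LadderInLex.refute ladder few free

-- The order of T_n on (colour , level), extended to all of Fin m × ℕ.
_≼_ : ∀ {m} → Fin m × ℕ → Fin m × ℕ → Set
(c , l) ≼ (c′ , l′) = (c Fin.≤ c′ × l ≤ l′) ⊎ (c′ Fin.< c × 2 + l ≤ l′)

Comparable : ∀ {m} → Fin m × ℕ → Fin m × ℕ → Set
Comparable p q = p ≼ q ⊎ q ≼ p

≼-of-gap : ∀ {m} {c c′ : Fin m} {l l′} → 2 + l ≤ l′ → (c , l) ≼ (c′ , l′)
≼-of-gap {c = c} {c′} {l} gap with toℕ c ≤? toℕ c′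
... | yes c≤c′ = inj₁ (c≤c′ , ≤-trans (m≤n+m l 2) gap)
... | no c≰c′  = inj₂ (≰⇒> c≰c′ , gap)

≼-isPartialOrder : ∀ {m} → IsPartialOrder _≡_ (_≼_ {m})
≼-isPartialOrder = record
  { isPreorder = record
    { isEquivalence = isEquivalence
    ; reflexive     = λ { refl → inj₁ (≤-refl , ≤-refl) }
    ; trans         = trans≼
    }
  ; antisym = antisym≼
  }
  where
  trans≼ : ∀ {p q r} → p ≼ q → q ≼ r → p ≼ r
  trans≼ (inj₁ (c₁≤c₂ , l₁≤l₂)) (inj₁ (c₂≤c₃ , l₂≤l₃)) = inj₁ (≤-trans c₁≤c₂ c₂≤c₃ , ≤-trans l₁≤l₂ l₂≤l₃)
  trans≼ (inj₁ (_ , l₁≤l₂)) (inj₂ (_ , gap)) = ≼-of-gap (≤-trans (+-monoʳ-≤ 2 l₁≤l₂) gap)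
  trans≼ (inj₂ (_ , gap)) (inj₁ (_ , l₂≤l₃)) = ≼-of-gap (≤-trans gap l₂≤l₃)
  trans≼ (inj₂ (_ , gap₁)) (inj₂ (_ , gap₂)) = ≼-of-gap (≤-trans gap₁ (≤-trans (m≤n+m _ 2) gap₂))

  antisym≼ : ∀ {p q} → p ≼ q → q ≼ p → p ≡ q
  antisym≼ (inj₁ (c≤c′ , l≤l′)) (inj₁ (c′≤c , l′≤l)) =
    cong₂ _,_ (Finₚ.≤-antisym c≤c′ c′≤c) (≤-antisym l≤l′ l′≤l)
  antisym≼ (inj₁ (_ , l≤l′)) (inj₂ (_ , gap)) = contradiction (≤-trans (n≤1+n _) (≤-trans gap l≤l′)) 1+n≰n
  antisym≼ (inj₂ (_ , gap)) (inj₁ (_ , l′≤l)) = contradiction (≤-trans (n≤1+n _) (≤-trans gap l′≤l)) 1+n≰n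
  antisym≼ (inj₂ (c′<c , _)) (inj₂ (c<c′ , _)) = contradiction c′<c (<-asym c<c′)

comparable-of-colour≡ : ∀ {m} {c c′ : Fin m} {l l′} → c ≡ c′ → Comparable (c , l) (c′ , l′)
comparable-of-colour≡ {l = l} {l′} refl with ≤-total l l′
... | inj₁ l≤l′ = inj₁ (inj₁ (≤-refl , l≤l′))
... | inj₂ l′≤l = inj₂ (inj₁ (≤-refl , l′≤l))

comparable-unless-adjacent : ∀ {m} {c c′ : Fin m} {l l′} → c Fin.< c′ → l ≢ suc l′ →
                             Comparable (c , l) (c′ , l′)
comparable-unless-adjacent {l = l} {l′} c<c′ l≢1+l′ with l ≤? l′
... | yes l≤l′ = inj₁ (inj₁ (<⇒≤ c<c′ , l≤l′))
... | no l≰l′  = inj₂ (≼-of-gap (≤∧≢⇒< (≰⇒> l≰l′) (l≢1+l′ ∘ sym)))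

incomparable-adjacent : ∀ {m} {c c′ : Fin m} {l} → c Fin.< c′ → ¬ Comparable (c , suc l) (c′ , l)
incomparable-adjacent c<c′ (inj₁ (inj₁ (_ , 1+l≤l))) = contradiction 1+l≤l (n≮n _)
incomparable-adjacent c<c′ (inj₁ (inj₂ (c′<c , _)))  = contradiction c′<c (<-asym c<c′)
incomparable-adjacent c<c′ (inj₂ (inj₁ (c′≤c , _)))  = contradiction c′≤c (<⇒≱ c<c′)
incomparable-adjacent c<c′ (inj₂ (inj₂ (_ , 2+l≤1+l))) = contradiction 2+l≤1+l (n≮n _)

incomparable-level : ∀ {m} {c c′ : Fin m} {l l′} → c Fin.< c′ → ¬ Comparable (c , l) (c′ , l′) →
                     l ≡ suc l′
incomparable-level {l = l} {l′} c<c′ incomparable with l ≟ suc l′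
... | yes l≡1+l′ = l≡1+l′
... | no l≢1+l′  = contradiction (comparable-unless-adjacent c<c′ l≢1+l′) incomparable

incomparable-determined : ∀ {m} {p p′ q : Fin m × ℕ} →
                          ¬ Comparable p q → ¬ Comparable p′ q → proj₁ p ≡ proj₁ p′ → p ≡ p′
incomparable-determined {p = c , l} {_ , l′} {cq , _} p∥q p′∥q refl with Finₚ.<-cmp c cq
... | tri< c<cq _ _ =
  cong (c ,_) (trans (incomparable-level c<cq p∥q) (sym (incomparable-level c<cq p′∥q)))
... | tri≈ _ c≡cq _ = contradiction (comparable-of-colour≡ c≡cq) p∥q
... | tri> _ _ cq<c = cong (c ,_) (suc-injective (trans (sym (incomparable-level cq<c (p∥q ∘ swap)))
                                                       (incomparable-level cq<c (p′∥q ∘ swap))))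

parity : ℕ → Fin 2
parity zero    = Fin.zero
parity (suc l) = Fin.opposite (parity l)

parity-suc : ∀ l → parity (suc l) ≢ parity l
parity-suc l with parity l
... | Fin.zero          = λ ()
... | Fin.suc Fin.zero  = λ ()

comparable-of-parity : ∀ {m} {c c′ : Fin m} {l l′} → parity l ≡ parity l′ → Comparable (c , l) (c′ , l′)
comparable-of-parity {c = c} {c′} {l} {l′} same with Finₚ.<-cmp c c′
... | tri< c<c′ _ _ = comparable-unless-adjacent c<c′ (λ { refl → parity-suc l′ same })
... | tri≈ _ c≡c′ _ = comparable-of-colour≡ c≡c′
... | tri> _ _ c′<c = swap (comparable-unless-adjacent c′<c (λ { refl → parity-suc l (sym same) }))

triangleSize : ℕ → ℕ
triangleSize zero    = 1
triangleSize (suc n) = suc (suc n) + triangleSize n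

-- position n x = (colour , level) of x in T_n; the first suc (suc n) elements of T_(suc n) are
-- the levels 0 … suc n of colour 0.
position : ∀ n → Fin (triangleSize n) → Fin (suc n) × ℕ
position zero    _ = Fin.zero , 0
position (suc n) x = [ (λ a → Fin.zero , toℕ a) , map₁ Fin.suc ∘ position n ]′ (splitAt (suc (suc n)) x)

position-bound : ∀ n x → toℕ (proj₁ (position n x)) + proj₂ (position n x) ≤ n
position-bound zero    _ = z≤n
position-bound (suc n) x with splitAt (suc (suc n)) x
... | inj₁ a = s≤s⁻¹ (Finₚ.toℕ<n a)
... | inj₂ y = s≤s (position-bound n y)

position-injective : ∀ n {x y} → position n x ≡ position n y → x ≡ y
position-injective zero    {Fin.zero} {Fin.zero} _ = refl
position-injective (suc n) {x} {y} same
  with splitAt (suc (suc n)) x in ex | splitAt (suc (suc n)) y in ey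
... | inj₁ a | inj₁ b = splitAt-injective (suc (suc n))
  (trans ex (trans (cong inj₁ (Finₚ.toℕ-injective (,-injectiveʳ same))) (sym ey)))
... | inj₂ a | inj₂ b = splitAt-injective (suc (suc n))
  (trans ex (trans (cong inj₂ (position-injective n (cong₂ _,_ (Finₚ.suc-injective (,-injectiveˡ same))
                                                              (,-injectiveʳ same))))
                   (sym ey)))
... | inj₁ _ | inj₂ _ = contradiction (,-injectiveˡ same) λ ()
... | inj₂ _ | inj₁ _ = contradiction (,-injectiveˡ same) λ ()

position-↑ˡ : ∀ n a → position (suc n) (a ↑ˡ triangleSize n) ≡ (Fin.zero , toℕ a)
position-↑ˡ n a rewrite Finₚ.splitAt-↑ˡ (suc (suc n)) a (triangleSize n) = refl

position-↑ʳ : ∀ n y → position (suc n) (suc (suc n) ↑ʳ y) ≡ map₁ Fin.suc (position n y)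
position-↑ʳ n y rewrite Finₚ.splitAt-↑ʳ (suc (suc n)) (triangleSize n) y = refl

position-surjective : ∀ n (c : Fin (suc n)) l → toℕ c + l ≤ n → ∃ λ x → position n x ≡ (c , l)
position-surjective zero    Fin.zero    zero  _     = Fin.zero , refl
position-surjective (suc n) Fin.zero    l     l≤1+n =
  fromℕ< (s≤s l≤1+n) ↑ˡ triangleSize n ,
  trans (position-↑ˡ n _) (cong (Fin.zero ,_) (Finₚ.toℕ-fromℕ< (s≤s l≤1+n)))
position-surjective (suc n) (Fin.suc c) l     bound
  with y , position≡ ← position-surjective n c l (s≤s⁻¹ bound)
  = suc (suc n) ↑ʳ y , trans (position-↑ʳ n y) (cong (map₁ Fin.suc) position≡)

earlier-of-colour< : ∀ n {x y} → proj₁ (position n x) Fin.< proj₁ (position n y) → x Fin.< y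
earlier-of-colour< zero    ()
earlier-of-colour< (suc n) {x} {y} lt with splitAt (suc (suc n)) x in ex | splitAt (suc (suc n)) y in ey
... | _      | inj₁ _ = contradiction lt n≮0
... | inj₁ a | inj₂ b
  with refl ← Finₚ.splitAt⁻¹-↑ˡ {i = x} ex | refl ← Finₚ.splitAt⁻¹-↑ʳ {i = y} ey = begin-strict
  toℕ (a ↑ˡ triangleSize n)      ≡⟨ Finₚ.toℕ-↑ˡ a (triangleSize n) ⟩
  toℕ a                          <⟨ Finₚ.toℕ<n a ⟩
  suc (suc n)                    ≤⟨ m≤m+n (suc (suc n)) (toℕ b) ⟩
  suc (suc n) + toℕ b            ≡⟨ Finₚ.toℕ-↑ʳ (suc (suc n)) b ⟨
  toℕ (suc (suc n) ↑ʳ b)         ∎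
  where open ≤-Reasoning
... | inj₂ a | inj₂ b with refl ← Finₚ.splitAt⁻¹-↑ʳ {i = x} ex | refl ← Finₚ.splitAt⁻¹-↑ʳ {i = y} ey =
  subst₂ _<_ (sym (Finₚ.toℕ-↑ʳ (suc (suc n)) a)) (sym (Finₚ.toℕ-↑ʳ (suc (suc n)) b))
         (+-monoʳ-< (suc (suc n)) (earlier-of-colour< n (s≤s⁻¹ lt)))

triangle : ℕ → FinPoset
triangle n = record
  { size = triangleSize n
  ; _⊑_  = _≼_ on position n
  ; isPO = isPartialOrder-on (position n) (position-injective n) ≼-isPartialOrder
  }

triangle-firstFit : ∀ n → FirstFitColouring (triangle n) (suc n)
triangle-firstFit n = record
  { colour     = colour
  ; surjective = λ c → map₂ (cong proj₁) (position-surjective n c 0 (subst (_≤ n) (sym (+-identityʳ _))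
                                                                         (s≤s⁻¹ (Finₚ.toℕ<n c))))
  ; fits       = λ _ → comparable-of-colour≡
  ; blocked    = blocked
  }
  where
  colour : Fin (triangleSize n) → Fin (suc n)
  colour = proj₁ ∘ position n

  level : Fin (triangleSize n) → ℕ
  level = proj₂ ∘ position n

  bound : ∀ i {c} → c Fin.< colour i → toℕ c + suc (level i) ≤ n
  bound i {c} c<ci = begin
    toℕ c + suc (level i)    ≡⟨ +-suc (toℕ c) (level i) ⟩
    suc (toℕ c) + level i    ≤⟨ +-monoˡ-≤ (level i) c<ci ⟩
    toℕ (colour i) + level i ≤⟨ position-bound n i ⟩
    n                        ∎
    where open ≤-Reasoning

  blocked : ∀ i {c} → c Fin.< colour i → ∃ λ t → t Fin.< i × colour t ≡ c × Incomp (triangle n) t i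
  blocked i {c} c<ci with t , position≡ ← position-surjective n c (suc (level i)) (bound i c<ci)
    = t , earlier-of-colour< n (subst (Fin._< colour i) (sym (cong proj₁ position≡)) c<ci) ,
      cong proj₁ position≡ ,
      subst (λ p → ¬ Comparable p (position n i)) (sym position≡) (incomparable-adjacent c<ci)

triangle-chainCover : ∀ n → ChainCover (triangle n) 2
triangle-chainCover n = record
  { chain = parity ∘ proj₂ ∘ position n ; comparable = comparable-of-parity }

triangle-incomparableToFewerThan : ∀ n → IncomparableToFewerThan (suc n) (triangle n)
triangle-incomparableToFewerThan n q h h-injective h∥q
  with Finₚ.pigeonhole (n<1+n (suc n)) (proj₁ (position n q) ∷ proj₁ ∘ position n ∘ h)
... | Fin.zero  , Fin.suc j , _   , q≡hj  = h∥q j (comparable-of-colour≡ (sym q≡hj))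
... | Fin.suc i , Fin.suc j , i<j , hi≡hj =
  Finₚ.<⇒≢ (s≤s⁻¹ i<j)
    (h-injective (position-injective n (incomparable-determined (h∥q i) (h∥q j) hi≡hj)))

tower : ℕ → ℕ → FinPoset
tower n zero    = point
tower n (suc t) = lex (triangle n) (tower n t)

tower-firstFit : ∀ n t → FirstFitColouring (tower n t) (suc n ^ t)
tower-firstFit n zero    = point-firstFit
tower-firstFit n (suc t) = lex-firstFit (triangle-firstFit n) (tower-firstFit n t)

tower-chainCover : ∀ n t → ChainCover (tower n t) (2 ^ t)
tower-chainCover n zero    = point-chainCover
tower-chainCover n (suc t) = lex-chainCover (triangle-chainCover n) (tower-chainCover n t)

tower-truncatedLadderFree : ∀ n t → TruncatedLadderFree (suc n) (tower n t)
tower-truncatedLadderFree n zero    = point-truncatedLadderFree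
tower-truncatedLadderFree n (suc t) =
  lex-truncatedLadderFree {triangle n} {tower n t}
    (triangle-incomparableToFewerThan n) (tower-truncatedLadderFree n t)

between-powers-of-two : ∀ w → 1 ≤ w → ∃ λ t → 2 ^ t ≤ w × w < 2 ^ suc t
between-powers-of-two 1             _ = 0 , ≤-refl , s≤s (s≤s z≤n)
between-powers-of-two (suc (suc w)) _ with between-powers-of-two (suc w) (s≤s z≤n)
... | t , 2^t≤1+w , 1+w<2^[1+t] with suc (suc w) <? 2 ^ suc t
...   | yes 2+w<2^[1+t] = t , m≤n⇒m≤1+n 2^t≤1+w , 2+w<2^[1+t]
...   | no  2+w≮2^[1+t] =
  suc t , ≮⇒≥ 2+w≮2^[1+t] , ≤-<-trans 1+w<2^[1+t] (^-monoʳ-< 2 (s≤s (s≤s z≤n)) (n<1+n (suc t)))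

2^-bound⇒powLgBound : ∀ {w a} t → w ≤ 2 ^ suc t → PowLgBound w a (a ^ t)
2^-bound⇒powLgBound {w} {a} t w≤2^[1+t] p q _ 2^p≤a^q = begin
  w ^ p             ≤⟨ ^-monoˡ-≤ p w≤2^[1+t] ⟩
  (2 ^ suc t) ^ p   ≡⟨ ^-swap 2 (suc t) p ⟩
  (2 ^ p) ^ suc t   ≤⟨ ^-monoˡ-≤ (suc t) 2^p≤a^q ⟩
  (a ^ q) ^ suc t   ≡⟨ ^-swap a q (suc t) ⟩
  (a ^ suc t) ^ q   ∎
  where
  open ≤-Reasoning
  ^-swap : ∀ m n o → (m ^ n) ^ o ≡ (m ^ o) ^ n
  ^-swap m n o = trans (^-*-assoc m n o) (trans (cong (m ^_) (*-comm n o)) (sym (^-*-assoc m o n)))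

lemma1p7 : (m w : ℕ) → 2 ≤ m → 1 ≤ w →
    Σ[ P ∈ FinPoset ] Σ[ σ ∈ Permutation′ (size P) ] Σ[ k ∈ ℕ ]
    (LadderFree m P × WidthAtMost P w × FirstFitUses P σ k ×
    PowLgBound w (m ∸ 1) k)
lemma1p7 (suc (suc r)) w (s≤s (s≤s z≤n)) 1≤w
  with t , 2^t≤w , w<2^[1+t] ← between-powers-of-two w 1≤w
  = tower r t , Permutation.id , suc r ^ t ,
    truncatedLadderFree⇒ladderFree (tower-truncatedLadderFree r t) ,
    chainCover⇒widthAtMost (tower-chainCover r t) 2^t≤w ,
    firstFitUses (tower-firstFit r t) ,
    2^-bound⇒powLgBound t (<⇒≤ w<2^[1+t])
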